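{- Let $T\in\mathsf{HTrc}_{\mathcal L}$, let $\varphi$ be a closed Hyper-maxHML formula such that the decentralized monitor $\mathcal D_\emptyset(\varphi)$ is defined, and let $\mathcal R$ be a weak bisimulation with $(\mathcal D_\emptyset(\varphi),\mathcal M_\emptyset(\varphi))\in\mathcal R$. If $T\notin[\![\varphi]\!]$, then $\mathcal D_\emptyset(\varphi)\triangleright T\rightarrowtail^*\mathsf{no}$.
   Context: Here $\mathcal D$ is an arbitrary decentralized synthesis function: a partial function assigning to pairs $(\sigma,\varphi)$ (a formula and a partial map from location variables to locations) a decentralized monitor $\mathcal D_\sigma(\varphi)$. Model. Fix a finite set $\mathsf{Act}$ of actions with $|\mathsf{Act}|\ge 2$ and a finite non-empty set $\mathcal L$ of locations. $\mathsf{Trc}=\mathsf{Act}^\omega$; a hypertrace is $T:\mathcal L\to\mathsf{Trc}$, $\mathsf{HTrc}_{\mathcal L}$ is the set of hypertraces; for $A:\mathcal L\to\mathsf{Act}$, $T\xrightarrow{A}T'$ iff $T(\ell)=A(\ell)\,T'(\ell)$ for all $\ell$; each $T$ has a unique such $(A,T')$, written $(hd(T),tl(T))$. Logic. Let $\Pi$ (location variables $\pi$) and $V$ (recursion variables $x$) be disjoint countably infinite sets. Formulas: $\varphi::=\mathsf{tt}\mid\mathsf{ff}\mid\varphi\wedge\varphi\mid\varphi\vee\varphi\mid\max x.\varphi\mid\min x.\varphi\mid x\mid\exists\pi.\varphi\mid\forall\pi.\varphi\mid\pi=\pi\mid\pi\neq\pi\mid[a_\pi]\varphi\mid\langle a_\pi\rangle\varphi$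 ($a\in\mathsf{Act}$), guarded, with pairwise distinct bound location variables distinct from free ones; closed means no free location or recursion variables; Hyper-maxHML = formulas without $\min$. Semantics $[\![\varphi]\!]^\rho_\sigma$ ($\rho:V\rightharpoonup 2^{\mathsf{HTrc}_{\mathcal L}}$, $\sigma:\Pi\rightharpoonup\mathcal L$): $\mathsf{tt}\mapsto\mathsf{HTrc}_{\mathcal L}$, $\mathsf{ff}\mapsto\emptyset$, $x\mapsto\rho(x)$, $\wedge/\vee$ intersection/union, $\max x.\psi\mapsto\bigcup\{S\mid S\subseteq[\![\psi]\!]^{\rho[x\mapsto S]}_\sigma\}$, $\min x.\psi\mapsto\bigcap\{S\mid S\supseteq[\![\psi]\!]^{\rho[x\mapsto S]}_\sigma\}$, $\exists\pi.\psi\mapsto\bigcup_{\ell}[\![\psi]\!]^\rho_{\sigma[\pi\mapsto\ell]}$, $\forall\pi.\psi\mapsto\bigcap_\ell[\![\psi]\!]^\rho_{\sigma[\pi\mapsto\ell]}$, $\pi=\pi'\mapsto\mathsf{HTrc}_{\mathcal L}$ if $\sigma(\pi)=\sigma(\pi')$ else $\emptyset$ (dually for $\neq$), $[a_\pi]\psi\mapsto\{T\mid hd(T)(\sigma(\pi))=a\Rightarrow tl(T)\in[\![\psi]\!]^\rho_\sigma\}$, $\langle a_\pi\rangle\psi\mapsto\{T\mid hd(T)(\sigma(\pi))=a\wedge tl(T)\in[\![\psi]\!]^\rho_\sigma\}$; $[\![\varphi]\!]=[\![\varphi]\!]^\emptyset_\emptyset$ for closed $\varphi$. Centralized monitors: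 $m::=\mathsf{yes}\mid\mathsf{no}\mid\mathsf{end}\mid a_\ell.m\mid m+m\mid m\oplus m\mid m\otimes m\mid\mathsf{rec}\,x.m\mid x$; verdicts $v\in\{\mathsf{yes},\mathsf{no},\mathsf{end}\}$; $\odot\in\{\otimes,\oplus\}$. Transitions $m\xrightarrow{A}m'$ (least relation): $v\xrightarrow{A}v$; $a_\ell.m\xrightarrow{A}m$ if $A(\ell)=a$; $a_\ell.m\xrightarrow{A}\mathsf{end}$ if $A(\ell)\neq a$; $\mathsf{rec}\,x.m\xrightarrow{A}m'$ if $m\{\mathsf{rec}\,x.m/x\}\xrightarrow{A}m'$; $m+n\xrightarrow{A}m'$ if $m\xrightarrow{A}m'$, $m+n\xrightarrow{A}n'$ if $n\xrightarrow{A}n'$; $m\odot n\xrightarrow{A}m'\odot n'$ if $m\xrightarrow{A}m'$ and $n\xrightarrow{A}n'$. Verdict evaluation $m\Rrightarrow v$: least relation closed under (each also with operands of $+,\otimes,\oplus$ swapped) $v\Rrightarrow v$; $m\odot n\Rrightarrow\mathsf{end}$ if both $\Rrightarrow\mathsf{end}$; $m\oplus n\Rrightarrow\mathsf{yes}$ if $m\Rrightarrow\mathsf{yes}$; $m\otimes n\Rrightarrow\mathsf{no}$ if $m\Rrightarrow\mathsf{no}$; $m+n\Rrightarrow v$ if $m\Rrightarrow v$; $m\oplus n\Rrightarrow v$ if $m\Rrightarrow\mathsf{no}$ and $n\Rrightarrow v$; $m\otimes n\Rrightarrow v$ if $m\Rrightarrow\mathsf{yes}$ and $n\Rrightarrow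 v$; $\mathsf{rec}\,x.m\Rrightarrow v$ if $m\{\mathsf{rec}\,x.m/x\}\Rrightarrow v$. Centralized instrumentation: $m\triangleright T\rightarrowtail m'\triangleright T'$ if $m\xrightarrow{A}m'$, $T\xrightarrow{A}T'$; $m\triangleright T\rightarrowtail v$ if $m\Rrightarrow v$. Centralized synthesis ($\varphi$ Hyper-maxHML, $\sigma$ defined on its free location variables): $\mathcal M_\sigma(\mathsf{tt})=\mathsf{yes}$, $\mathcal M_\sigma(\mathsf{ff})=\mathsf{no}$, $\mathcal M_\sigma(x)=x$, $\mathcal M_\sigma(\max x.\varphi)=\mathsf{rec}\,x.\mathcal M_\sigma(\varphi)$, $\wedge\mapsto\otimes$, $\vee\mapsto\oplus$, $\mathcal M_\sigma(\forall\pi.\varphi)=\bigotimes_{\ell\in\mathcal L}\mathcal M_{\sigma[\pi\mapsto\ell]}(\varphi)$, $\mathcal M_\sigma(\exists\pi.\varphi)=\bigoplus_{\ell\in\mathcal L}\mathcal M_{\sigma[\pi\mapsto\ell]}(\varphi)$, $\mathcal M_\sigma(\pi=\pi')=\mathsf{yes}$ if $\sigma(\pi)=\sigma(\pi')$ else $\mathsf{no}$, $\mathcal M_\sigma(\pi\neq\pi')=\mathsf{yes}$ if $\sigma(\pi)\neq\sigma(\pi')$ else $\mathsf{no}$, $\mathcal M_\sigma([a_\pi]\varphi)=a_{\sigma(\pi)}.\mathcal M_\sigma(\varphi)+\sum_{b\neq a}b_{\sigma(\pi)}.\mathsf{yes}$, $\mathcal M_\sigma(\langle a_\pi\rangle\varphi)=a_{\sigma(\pi)}.\mathcal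 M_\sigma(\varphi)+\sum_{b\neq a}b_{\sigma(\pi)}.\mathsf{no}$. Decentralized monitors. Let $\mathsf{Con}\supseteq\mathsf{Act}$ be a finite set of communication constants; communication actions are $(!G,\gamma)$ and $(?G,\gamma)$ with $G\subseteq\mathcal L$, $\gamma\in\mathsf{Con}$. $M::=[m]_\ell\mid M\vee M\mid M\wedge M$; local monitors $m::=\mathsf{yes}\mid\mathsf{no}\mid\mathsf{end}\mid a.m\mid c.m\mid m+m\mid m\oplus m\mid m\otimes m\mid\mathsf{rec}\,x.m\mid x$. Local transitions, labels $\lambda\in\mathsf{Act}\cup\{(!G,\gamma)\}\cup\{(?\ell,\gamma)\}$ (also with operands of $+,\otimes,\oplus$ swapped): $a.m\xrightarrow{a}m$; $(?G,\gamma).m\xrightarrow{(?\ell,\gamma)}m$ if $\ell\in G$; $(!G,\gamma).m\xrightarrow{(!G,\gamma)}m$; $v\xrightarrow{a}v$; $\mathsf{rec}\,x.m\xrightarrow{\lambda}m'$ if $m\{\mathsf{rec}\,x.m/x\}\xrightarrow{\lambda}m'$; $m\odot n\xrightarrow{a}m'\odot n'$ if both move by $a$; $m\odot n\xrightarrow{(?\ell,\gamma)}m'\odot n'$ if both move by $(?\ell,\gamma)$; $m+n\xrightarrow{\lambda}m'$ if $m\xrightarrow{\lambda}m'$; $m\odot n\xrightarrow{(!G,\gamma)}m'\odot n$ if $m\xrightarrow{(!G,\gamma)}m'$; $m\odot n\xrightarrow{(?\ell,\gamma)}m'\odot n$ if $m\xrightarrow{(?\ell,\gamma)}m'$ and $n$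 has no $(?\ell,\gamma)$-transition. Decentralized rules ($\diamond\in\{\wedge,\vee\}$, also swapped): $[m]_\ell\xrightarrow{\ell:(!G,\gamma)}[m']_\ell$ if $m\xrightarrow{(!G,\gamma)}m'$; $[m]_\ell\overset{G:(?\ell',\gamma)}{\rightsquigarrow}[m']_\ell$ if $m\xrightarrow{(?\ell',\gamma)}m'$ and $\ell\in G$; $[m]_\ell\overset{G:(?\ell',\gamma)}{\rightsquigarrow}[m]_\ell$ if $m$ has no $(?\ell',\gamma)$-transition or $\ell\notin G$; $M\diamond N\overset{G:(?\ell,\gamma)}{\rightsquigarrow}M'\diamond N'$ if both do; $M\diamond N\xrightarrow{\ell:(!G,\gamma)}M'\diamond N'$ if $M\xrightarrow{\ell:(!G,\gamma)}M'$ and $N\overset{G:(?\ell,\gamma)}{\rightsquigarrow}N'$; $[m]_\ell\xrightarrow{A}[m']_\ell$ if $A(\ell)=a$, $m\xrightarrow{a}m'$; $[m]_\ell\xrightarrow{A}[\mathsf{end}]_\ell$ if $A(\ell)=a$ and $m$ has neither an $a$-transition nor any communication-labelled transition; $M\diamond N\xrightarrow{A}M'\diamond N'$ if both move by $A$. Verdicts: $[m]_\ell\Rrightarrow v$ if $m\Rrightarrow v$; $M\diamond N\Rrightarrow\mathsf{end}$ if both $\Rrightarrow\mathsf{end}$; $M\wedge N\Rrightarrow\mathsf{no}$ if $M\Rrightarrow\mathsf{no}$; $M\wedge N\Rrightarrow v$ if $M\Rrightarrow\mathsf{yes}$, $N\Rrightarrow v$; $M\vee N\Rrightarrow\mathsf{yes}$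 if $M\Rrightarrow\mathsf{yes}$; $M\vee N\Rrightarrow v$ if $M\Rrightarrow\mathsf{no}$, $N\Rrightarrow v$ (also swapped). Instrumentation: $M\triangleright T\rightarrowtail M'\triangleright T'$ if $M\xrightarrow{A}M'$, $T\xrightarrow{A}T'$; $M\triangleright T\rightarrowtail M'\triangleright T$ if $M\xrightarrow{\ell:(!G,\gamma)}M'$; $M\triangleright T\rightarrowtail v$ if $M\Rrightarrow v$; $\rightarrowtail^*$ reflexive-transitive closure. $M\Rightarrow_c M'$: $M'$ reached by finitely many (possibly zero) transitions labelled $\ell_i:(!G_i,\gamma_i)$. Weak bisimulation: a relation $\mathcal R$ between decentralized and centralized monitors such that whenever $M\,\mathcal R\,m$: (1) for every verdict $v$, there exists $M'$ with $M\Rightarrow_c M'$ and $M'\Rrightarrow v$ iff $m\Rrightarrow v$; (2) if $M\xrightarrow{A}M'$ then $m\xrightarrow{A}m'$ for some $m'$ with $M'\,\mathcal R\,m'$; (3) if $M\xrightarrow{\ell:(!G,\gamma)}M'$ then $M'\,\mathcal R\,m$; (4) if $m\xrightarrow{A}m'$ then $M\Rightarrow_c M_1\xrightarrow{A}M_2\Rightarrow_c M'$ for some $M_1,M_2,M'$ with $M'\,\mathcal R\,m'$. -}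

module Defs where

open import Level using (Level; 0ℓ; Lift) renaming (suc to lsuc)
open import Function using (_∘_)
open import Data.Nat using (ℕ; zero; suc) renaming (_≟_ to _≟ℕ_)
open import Data.Fin using (Fin) renaming (_≟_ to _≟F_)
open import Data.Fin.Subset using (Subset) renaming (_∈_ to _∈ₛ_; _∉_ to _∉ₛ_)
open import Data.List using (List; []; _∷_; _++_; foldl; filterᵇ; allFin)
open import Data.List.Membership.Propositional using () renaming (_∈_ to _∈ₗ_; _∉_ to _∉ₗ_)
open import Data.List.Relation.Unary.Unique.Propositional using (Unique)
open import Data.Maybe using (Maybe; just; nothing)
open import Data.Product using (Σ; ∃; ∃₂; _×_; _,_)
open import Data.Sum using (_⊎_)
open import Data.Unit using (⊤)
open import Data.Empty using (⊥)
open import Data.Bool using (Bool; true; false; if_then_else_; not)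
open import Relation.Nullary using (¬_)
open import Relation.Nullary.Decidable using (⌊_⌋)
open import Relation.Binary.PropositionalEquality using (_≡_; _≢_)
open import Relation.Binary.Construct.Closure.ReflexiveTransitive using (Star)

data Verdict : Set where
  yes no end : Verdict

data Op : Set where
  ⊕ ⊗ : Op

data Mon (P : Set) : Set where
  ⌈_⌉   : Verdict → Mon P
  pre   : P → Mon P → Mon P
  _+ₘ_  : Mon P → Mon P → Mon P
  bin   : Op → Mon P → Mon P → Mon P
  rec   : ℕ → Mon P → Mon P
  var   : ℕ → Mon P

-- m{n/x} (the standard substitution; only closed terms are ever substituted
-- by the rec-unfolding rules applied to closed monitors)
msubst : {P : Set} → Mon P → ℕ → Mon P → Mon P
msubst ⌈ v ⌉ x n = ⌈ v ⌉
msubst (pre p m) x n = pre p (msubst m x n)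
msubst (m +ₘ m') x n = msubst m x n +ₘ msubst m' x n
msubst (bin o m m') x n = bin o (msubst m x n) (msubst m' x n)
msubst (rec y m) x n = if ⌊ y ≟ℕ x ⌋ then rec y m else rec y (msubst m x n)
msubst (var y) x n = if ⌊ y ≟ℕ x ⌋ then n else var y

unfold : {P : Set} → ℕ → Mon P → Mon P
unfold x m = msubst m x (rec x m)

data _⇛_ {P : Set} : Mon P → Verdict → Set where
  ev-verd  : ∀ {v} → ⌈ v ⌉ ⇛ v
  ev-end   : ∀ {o m n} → m ⇛ end → n ⇛ end → bin o m n ⇛ end
  ev-⊕yesL : ∀ {m n} → m ⇛ yes → bin ⊕ m n ⇛ yes
  ev-⊕yesR : ∀ {m n} → n ⇛ yes → bin ⊕ m n ⇛ yes
  ev-⊗noL  : ∀ {m n} → m ⇛ no → bin ⊗ m n ⇛ no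
  ev-⊗noR  : ∀ {m n} → n ⇛ no → bin ⊗ m n ⇛ no
  ev-+L    : ∀ {m n v} → m ⇛ v → (m +ₘ n) ⇛ v
  ev-+R    : ∀ {m n v} → n ⇛ v → (m +ₘ n) ⇛ v
  ev-⊕noL  : ∀ {m n v} → m ⇛ no → n ⇛ v → bin ⊕ m n ⇛ v
  ev-⊕noR  : ∀ {m n v} → n ⇛ no → m ⇛ v → bin ⊕ m n ⇛ v
  ev-⊗yesL : ∀ {m n v} → m ⇛ yes → n ⇛ v → bin ⊗ m n ⇛ v
  ev-⊗yesR : ∀ {m n v} → n ⇛ yes → m ⇛ v → bin ⊗ m n ⇛ v
  ev-rec   : ∀ {x m v} → unfold x m ⇛ v → rec x m ⇛ v

-- The model, parameterised by:
--   Act = Fin (2 + nA′)       (finite, |Act| ≥ 2)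
--   𝓛   = Fin (1 + nL′)       (finite, non-empty)
--   Con = Act ⊎ Fin k         (finite set of communication constants ⊇ Act)

module Model (nA′ nL′ k : ℕ) where

  Act : Set
  Act = Fin (suc (suc nA′))

  Loc : Set
  Loc = Fin (suc nL′)

  Con : Set
  Con = Act ⊎ Fin k

  LocSet : Set
  LocSet = Subset (suc nL′)

  Trc : Set
  Trc = ℕ → Act

  HTrc : Set
  HTrc = Loc → Trc

  hd : HTrc → (Loc → Act)
  hd T ℓ = T ℓ 0

  tl : HTrc → HTrc
  tl T ℓ n = T ℓ (suc n)

  _—[_]→ₜ_ : HTrc → (Loc → Act) → HTrc → Set
  T —[ A ]→ₜ T′ = ∀ ℓ → (T ℓ 0 ≡ A ℓ) × (∀ n → T ℓ (suc n) ≡ T′ ℓ n)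

  -- Logic.  Location variables Π = ℕ, recursion variables V = ℕ.

  data Formula : Set where
    tt ff      : Formula
    _∧_ _∨_    : Formula → Formula → Formula
    max min    : ℕ → Formula → Formula
    rvar       : ℕ → Formula
    ex all     : ℕ → Formula → Formula
    _=ₗ_ _≠ₗ_  : ℕ → ℕ → Formula
    [_at_]_    : Act → ℕ → Formula → Formula
    ⟨_at_⟩_    : Act → ℕ → Formula → Formula

  -- The list holds the recursion variables
  -- bound so far without an intervening modality.
  Guarded : List ℕ → Formula → Set
  Guarded U tt = ⊤
  Guarded U ff = ⊤
  Guarded U (φ ∧ ψ) = Guarded U φ × Guarded U ψ
  Guarded U (φ ∨ ψ) = Guarded U φ × Guarded U ψ
  Guarded U (max x φ) = Guarded (x ∷ U) φ
  Guarded U (min x φ) = Guarded (x ∷ U) φ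
  Guarded U (rvar x) = x ∉ₗ U
  Guarded U (ex π φ) = Guarded U φ
  Guarded U (all π φ) = Guarded U φ
  Guarded U (π =ₗ π′) = ⊤
  Guarded U (π ≠ₗ π′) = ⊤
  Guarded U ([ a at π ] φ) = Guarded [] φ
  Guarded U (⟨ a at π ⟩ φ) = Guarded [] φ

  boundLoc : Formula → List ℕ
  boundLoc (φ ∧ ψ) = boundLoc φ ++ boundLoc ψ
  boundLoc (φ ∨ ψ) = boundLoc φ ++ boundLoc ψ
  boundLoc (max x φ) = boundLoc φ
  boundLoc (min x φ) = boundLoc φ
  boundLoc (ex π φ) = π ∷ boundLoc φ
  boundLoc (all π φ) = π ∷ boundLoc φ
  boundLoc ([ a at π ] φ) = boundLoc φ
  boundLoc (⟨ a at π ⟩ φ) = boundLoc φ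
  boundLoc _ = []

  ClosedIn : List ℕ → List ℕ → Formula → Set
  ClosedIn Ps Xs tt = ⊤
  ClosedIn Ps Xs ff = ⊤
  ClosedIn Ps Xs (φ ∧ ψ) = ClosedIn Ps Xs φ × ClosedIn Ps Xs ψ
  ClosedIn Ps Xs (φ ∨ ψ) = ClosedIn Ps Xs φ × ClosedIn Ps Xs ψ
  ClosedIn Ps Xs (max x φ) = ClosedIn Ps (x ∷ Xs) φ
  ClosedIn Ps Xs (min x φ) = ClosedIn Ps (x ∷ Xs) φ
  ClosedIn Ps Xs (rvar x) = x ∈ₗ Xs
  ClosedIn Ps Xs (ex π φ) = ClosedIn (π ∷ Ps) Xs φ
  ClosedIn Ps Xs (all π φ) = ClosedIn (π ∷ Ps) Xs φ
  ClosedIn Ps Xs (π =ₗ π′) = (π ∈ₗ Ps) × (π′ ∈ₗ Ps)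
  ClosedIn Ps Xs (π ≠ₗ π′) = (π ∈ₗ Ps) × (π′ ∈ₗ Ps)
  ClosedIn Ps Xs ([ a at π ] φ) = (π ∈ₗ Ps) × ClosedIn Ps Xs φ
  ClosedIn Ps Xs (⟨ a at π ⟩ φ) = (π ∈ₗ Ps) × ClosedIn Ps Xs φ

  ClosedFormula : Formula → Set
  ClosedFormula φ = Guarded [] φ × Unique (boundLoc φ) × ClosedIn [] [] φ

  -- Hyper-maxHML: no min
  MinFree : Formula → Set
  MinFree (φ ∧ ψ) = MinFree φ × MinFree ψ
  MinFree (φ ∨ ψ) = MinFree φ × MinFree ψ
  MinFree (max x φ) = MinFree φ
  MinFree (min x φ) = ⊥
  MinFree (ex π φ) = MinFree φ
  MinFree (all π φ) = MinFree φ
  MinFree ([ a at π ] φ) = MinFree φ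
  MinFree (⟨ a at π ⟩ φ) = MinFree φ
  MinFree _ = ⊤

  LocEnv : Set
  LocEnv = ℕ → Maybe Loc

  σ∅ : LocEnv
  σ∅ _ = nothing

  _[_↦_] : LocEnv → ℕ → Loc → LocEnv
  (σ [ π ↦ ℓ ]) π′ = if ⌊ π′ ≟ℕ π ⌋ then just ℓ else σ π′

  HSet : Set₁
  HSet = HTrc → Set

  RecEnv : Set₁
  RecEnv = ℕ → HSet

  ρ∅ : RecEnv
  ρ∅ _ _ = ⊥

  _[_↦ᵣ_] : RecEnv → ℕ → HSet → RecEnv
  (ρ [ x ↦ᵣ S ]) y = if ⌊ y ≟ℕ x ⌋ then S else ρ y

  atLoc : Maybe Loc → (Loc → Set₁) → Set₁
  atLoc nothing P = Lift _ ⊥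
  atLoc (just ℓ) P = P ℓ

  ⟦_⟧ : Formula → RecEnv → LocEnv → HTrc → Set₁
  ⟦ tt ⟧ ρ σ T = Lift _ ⊤
  ⟦ ff ⟧ ρ σ T = Lift _ ⊥
  ⟦ φ ∧ ψ ⟧ ρ σ T = ⟦ φ ⟧ ρ σ T × ⟦ ψ ⟧ ρ σ T
  ⟦ φ ∨ ψ ⟧ ρ σ T = ⟦ φ ⟧ ρ σ T ⊎ ⟦ ψ ⟧ ρ σ T
  ⟦ max x ψ ⟧ ρ σ T =
    Σ HSet λ S → (∀ T′ → S T′ → ⟦ ψ ⟧ (ρ [ x ↦ᵣ S ]) σ T′) × S T
  ⟦ min x ψ ⟧ ρ σ T =
    (S : HSet) → (∀ T′ → ⟦ ψ ⟧ (ρ [ x ↦ᵣ S ]) σ T′ → S T′) → S T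
  ⟦ rvar x ⟧ ρ σ T = Lift _ (ρ x T)
  ⟦ ex π ψ ⟧ ρ σ T = Σ Loc λ ℓ → ⟦ ψ ⟧ ρ (σ [ π ↦ ℓ ]) T
  ⟦ all π ψ ⟧ ρ σ T = (ℓ : Loc) → ⟦ ψ ⟧ ρ (σ [ π ↦ ℓ ]) T
  ⟦ π =ₗ π′ ⟧ ρ σ T = atLoc (σ π) λ ℓ → atLoc (σ π′) λ ℓ′ → Lift _ (ℓ ≡ ℓ′)
  ⟦ π ≠ₗ π′ ⟧ ρ σ T = atLoc (σ π) λ ℓ → atLoc (σ π′) λ ℓ′ → Lift _ (ℓ ≢ ℓ′)
  ⟦ [ a at π ] ψ ⟧ ρ σ T = atLoc (σ π) λ ℓ → hd T ℓ ≡ a → ⟦ ψ ⟧ ρ σ (tl T)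
  ⟦ ⟨ a at π ⟩ ψ ⟧ ρ σ T = atLoc (σ π) λ ℓ → (hd T ℓ ≡ a) × ⟦ ψ ⟧ ρ σ (tl T)

  ⟦_⟧∅ : Formula → HTrc → Set₁
  ⟦ φ ⟧∅ = ⟦ φ ⟧ ρ∅ σ∅

  CMon : Set
  CMon = Mon (Act × Loc)

  data _—[_]→ᶜ_ : CMon → (Loc → Act) → CMon → Set where
    c-verd  : ∀ {v A} → ⌈ v ⌉ —[ A ]→ᶜ ⌈ v ⌉
    c-pre   : ∀ {a ℓ m A} → A ℓ ≡ a → pre (a , ℓ) m —[ A ]→ᶜ m
    c-preE  : ∀ {a ℓ m A} → A ℓ ≢ a → pre (a , ℓ) m —[ A ]→ᶜ ⌈ end ⌉
    c-rec   : ∀ {x m m′ A} → unfold x m —[ A ]→ᶜ m′ → rec x m —[ A ]→ᶜ m′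
    c-+L    : ∀ {m n m′ A} → m —[ A ]→ᶜ m′ → (m +ₘ n) —[ A ]→ᶜ m′
    c-+R    : ∀ {m n n′ A} → n —[ A ]→ᶜ n′ → (m +ₘ n) —[ A ]→ᶜ n′
    c-bin   : ∀ {o m n m′ n′ A} → m —[ A ]→ᶜ m′ → n —[ A ]→ᶜ n′ →
              bin o m n —[ A ]→ᶜ bin o m′ n′

  bigOp : Op → ∀ {n} → (Fin (suc n) → CMon) → CMon
  bigOp o {zero} f = f Fin.zero
  bigOp o {suc n} f = bin o (f Fin.zero) (bigOp o (f ∘ Fin.suc))

  others : Act → List Act
  others a = filterᵇ (λ b → not ⌊ b ≟F a ⌋) (allFin _)

  modal : Act → Loc → CMon → Verdict → CMon
  modal a ℓ m v = foldl (λ acc b → acc +ₘ pre (b , ℓ) ⌈ v ⌉) (pre (a , ℓ) m) (others a)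

  -- It is only meaningful on Hyper-maxHML
  -- formulas with σ defined on the free location variables; outside that
  -- domain (min, undefined σ) an arbitrary value ⌈ end ⌉ is returned.
  𝓜 : LocEnv → Formula → CMon
  𝓜 σ tt = ⌈ yes ⌉
  𝓜 σ ff = ⌈ no ⌉
  𝓜 σ (rvar x) = var x
  𝓜 σ (max x φ) = rec x (𝓜 σ φ)
  𝓜 σ (min x φ) = ⌈ end ⌉
  𝓜 σ (φ ∧ ψ) = bin ⊗ (𝓜 σ φ) (𝓜 σ ψ)
  𝓜 σ (φ ∨ ψ) = bin ⊕ (𝓜 σ φ) (𝓜 σ ψ)
  𝓜 σ (all π φ) = bigOp ⊗ (λ ℓ → 𝓜 (σ [ π ↦ ℓ ]) φ)
  𝓜 σ (ex π φ) = bigOp ⊕ (λ ℓ → 𝓜 (σ [ π ↦ ℓ ]) φ)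
  𝓜 σ (π =ₗ π′) with σ π | σ π′
  ... | just ℓ | just ℓ′ = if ⌊ ℓ ≟F ℓ′ ⌋ then ⌈ yes ⌉ else ⌈ no ⌉
  ... | _ | _ = ⌈ end ⌉
  𝓜 σ (π ≠ₗ π′) with σ π | σ π′
  ... | just ℓ | just ℓ′ = if ⌊ ℓ ≟F ℓ′ ⌋ then ⌈ no ⌉ else ⌈ yes ⌉
  ... | _ | _ = ⌈ end ⌉
  𝓜 σ ([ a at π ] φ) with σ π
  ... | just ℓ = modal a ℓ (𝓜 σ φ) yes
  ... | nothing = ⌈ end ⌉
  𝓜 σ (⟨ a at π ⟩ φ) with σ π
  ... | just ℓ = modal a ℓ (𝓜 σ φ) no
  ... | nothing = ⌈ end ⌉

  data LPre : Set where
    act  : Act → LPre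
    send : LocSet → Con → LPre
    recv : LocSet → Con → LPre

  LMon : Set
  LMon = Mon LPre

  data Label : Set where
    l-act  : Act → Label
    l-send : LocSet → Con → Label
    l-recv : Loc → Con → Label

  IsComm : Label → Set
  IsComm (l-act _) = ⊥
  IsComm _ = ⊤

  -- "m has a (?ℓ,γ)-transition", characterised inductively (positively) so
  -- that it can serve as the negative premise of the local transition rules.
  data CanRecv (ℓ : Loc) (γ : Con) : LMon → Set where
    cr-pre  : ∀ {G m} → ℓ ∈ₛ G → CanRecv ℓ γ (pre (recv G γ) m)
    cr-rec  : ∀ {x m} → CanRecv ℓ γ (unfold x m) → CanRecv ℓ γ (rec x m)
    cr-+L   : ∀ {m n} → CanRecv ℓ γ m → CanRecv ℓ γ (m +ₘ n)
    cr-+R   : ∀ {m n} → CanRecv ℓ γ n → CanRecv ℓ γ (m +ₘ n)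
    cr-binL : ∀ {o m n} → CanRecv ℓ γ m → CanRecv ℓ γ (bin o m n)
    cr-binR : ∀ {o m n} → CanRecv ℓ γ n → CanRecv ℓ γ (bin o m n)

  data _—⟨_⟩→_ : LMon → Label → LMon → Set where
    l-pre-act  : ∀ {a m} → pre (act a) m —⟨ l-act a ⟩→ m
    l-pre-recv : ∀ {G γ ℓ m} → ℓ ∈ₛ G → pre (recv G γ) m —⟨ l-recv ℓ γ ⟩→ m
    l-pre-send : ∀ {G γ m} → pre (send G γ) m —⟨ l-send G γ ⟩→ m
    l-verd     : ∀ {v a} → ⌈ v ⌉ —⟨ l-act a ⟩→ ⌈ v ⌉
    l-rec      : ∀ {x m m′ λ′} → unfold x m —⟨ λ′ ⟩→ m′ → rec x m —⟨ λ′ ⟩→ m′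
    l-bin-act  : ∀ {o m n m′ n′ a} → m —⟨ l-act a ⟩→ m′ → n —⟨ l-act a ⟩→ n′ →
                 bin o m n —⟨ l-act a ⟩→ bin o m′ n′
    l-bin-recv : ∀ {o m n m′ n′ ℓ γ} → m —⟨ l-recv ℓ γ ⟩→ m′ → n —⟨ l-recv ℓ γ ⟩→ n′ →
                 bin o m n —⟨ l-recv ℓ γ ⟩→ bin o m′ n′
    l-+L       : ∀ {m n m′ λ′} → m —⟨ λ′ ⟩→ m′ → (m +ₘ n) —⟨ λ′ ⟩→ m′
    l-+R       : ∀ {m n n′ λ′} → n —⟨ λ′ ⟩→ n′ → (m +ₘ n) —⟨ λ′ ⟩→ n′
    l-bin-sendL : ∀ {o m n m′ G γ} → m —⟨ l-send G γ ⟩→ m′ →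
                  bin o m n —⟨ l-send G γ ⟩→ bin o m′ n
    l-bin-sendR : ∀ {o m n n′ G γ} → n —⟨ l-send G γ ⟩→ n′ →
                  bin o m n —⟨ l-send G γ ⟩→ bin o m n′
    l-bin-recvL : ∀ {o m n m′ ℓ γ} → m —⟨ l-recv ℓ γ ⟩→ m′ → ¬ CanRecv ℓ γ n →
                  bin o m n —⟨ l-recv ℓ γ ⟩→ bin o m′ n
    l-bin-recvR : ∀ {o m n n′ ℓ γ} → n —⟨ l-recv ℓ γ ⟩→ n′ → ¬ CanRecv ℓ γ m →
                  bin o m n —⟨ l-recv ℓ γ ⟩→ bin o m n′

  data Conn : Set where
    ∨ᴰ ∧ᴰ : Conn

  data DMon : Set where
    [_]at_ : LMon → Loc → DMon
    dbin   : Conn → DMon → DMon → DMon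

  data _⇝[_∶?_,_]_ : DMon → LocSet → Loc → Con → DMon → Set where
    r-move : ∀ {m m′ ℓ G ℓ′ γ} → m —⟨ l-recv ℓ′ γ ⟩→ m′ → ℓ ∈ₛ G →
             ([ m ]at ℓ) ⇝[ G ∶? ℓ′ , γ ] ([ m′ ]at ℓ)
    r-stay : ∀ {m ℓ G ℓ′ γ} → (¬ (∃ λ m′ → m —⟨ l-recv ℓ′ γ ⟩→ m′) ⊎ ℓ ∉ₛ G) →
             ([ m ]at ℓ) ⇝[ G ∶? ℓ′ , γ ] ([ m ]at ℓ)
    r-bin  : ∀ {c M N M′ N′ G ℓ γ} → M ⇝[ G ∶? ℓ , γ ] M′ → N ⇝[ G ∶? ℓ , γ ] N′ →
             dbin c M N ⇝[ G ∶? ℓ , γ ] dbin c M′ N′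

  data _—[_∶!_,_]→_ : DMon → Loc → LocSet → Con → DMon → Set where
    s-loc  : ∀ {m m′ ℓ G γ} → m —⟨ l-send G γ ⟩→ m′ →
             ([ m ]at ℓ) —[ ℓ ∶! G , γ ]→ ([ m′ ]at ℓ)
    s-binL : ∀ {c M N M′ N′ ℓ G γ} → M —[ ℓ ∶! G , γ ]→ M′ → N ⇝[ G ∶? ℓ , γ ] N′ →
             dbin c M N —[ ℓ ∶! G , γ ]→ dbin c M′ N′
    s-binR : ∀ {c M N M′ N′ ℓ G γ} → N —[ ℓ ∶! G , γ ]→ N′ → M ⇝[ G ∶? ℓ , γ ] M′ →
             dbin c M N —[ ℓ ∶! G , γ ]→ dbin c M′ N′

  data _—[_]→ᴰ_ : DMon → (Loc → Act) → DMon → Set where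
    d-move : ∀ {m m′ ℓ A a} → A ℓ ≡ a → m —⟨ l-act a ⟩→ m′ →
             ([ m ]at ℓ) —[ A ]→ᴰ ([ m′ ]at ℓ)
    d-end  : ∀ {m ℓ A a} → A ℓ ≡ a →
             ¬ (∃ λ m′ → m —⟨ l-act a ⟩→ m′) →
             ¬ (∃₂ λ λ′ m′ → IsComm λ′ × (m —⟨ λ′ ⟩→ m′)) →
             ([ m ]at ℓ) —[ A ]→ᴰ ([ ⌈ end ⌉ ]at ℓ)
    d-bin  : ∀ {c M N M′ N′ A} → M —[ A ]→ᴰ M′ → N —[ A ]→ᴰ N′ →
             dbin c M N —[ A ]→ᴰ dbin c M′ N′

  data _⇛ᴰ_ : DMon → Verdict → Set where
    dv-loc    : ∀ {m ℓ v} → m ⇛ v → ([ m ]at ℓ) ⇛ᴰ v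
    dv-end    : ∀ {c M N} → M ⇛ᴰ end → N ⇛ᴰ end → dbin c M N ⇛ᴰ end
    dv-∧noL   : ∀ {M N} → M ⇛ᴰ no → dbin ∧ᴰ M N ⇛ᴰ no
    dv-∧noR   : ∀ {M N} → N ⇛ᴰ no → dbin ∧ᴰ M N ⇛ᴰ no
    dv-∧yesL  : ∀ {M N v} → M ⇛ᴰ yes → N ⇛ᴰ v → dbin ∧ᴰ M N ⇛ᴰ v
    dv-∧yesR  : ∀ {M N v} → N ⇛ᴰ yes → M ⇛ᴰ v → dbin ∧ᴰ M N ⇛ᴰ v
    dv-∨yesL  : ∀ {M N} → M ⇛ᴰ yes → dbin ∨ᴰ M N ⇛ᴰ yes
    dv-∨yesR  : ∀ {M N} → N ⇛ᴰ yes → dbin ∨ᴰ M N ⇛ᴰ yes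
    dv-∨noL   : ∀ {M N v} → M ⇛ᴰ no → N ⇛ᴰ v → dbin ∨ᴰ M N ⇛ᴰ v
    dv-∨noR   : ∀ {M N v} → N ⇛ᴰ no → M ⇛ᴰ v → dbin ∨ᴰ M N ⇛ᴰ v

  data Conf : Set where
    ⟪_▷_⟫   : DMon → HTrc → Conf
    verdict : Verdict → Conf

  data _↣_ : Conf → Conf → Set where
    i-act  : ∀ {M M′ T T′ A} → M —[ A ]→ᴰ M′ → T —[ A ]→ₜ T′ → ⟪ M ▷ T ⟫ ↣ ⟪ M′ ▷ T′ ⟫
    i-comm : ∀ {M M′ T ℓ G γ} → M —[ ℓ ∶! G , γ ]→ M′ → ⟪ M ▷ T ⟫ ↣ ⟪ M′ ▷ T ⟫
    i-verd : ∀ {M T v} → M ⇛ᴰ v → ⟪ M ▷ T ⟫ ↣ verdict v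

  _↣*_ : Conf → Conf → Set
  _↣*_ = Star _↣_

  CommStep : DMon → DMon → Set
  CommStep M M′ = Σ Loc λ ℓ → Σ LocSet λ G → Σ Con λ γ → M —[ ℓ ∶! G , γ ]→ M′

  _⇒c_ : DMon → DMon → Set
  _⇒c_ = Star CommStep

  record WeakBisim (R : DMon → CMon → Set) : Set where
    field
      wb-verdict : ∀ {M m} → R M m → ∀ v →
                   ((∃ λ M′ → (M ⇒c M′) × (M′ ⇛ᴰ v)) → m ⇛ v) ×
                   (m ⇛ v → ∃ λ M′ → (M ⇒c M′) × (M′ ⇛ᴰ v))
      wb-act     : ∀ {M m M′ A} → R M m → M —[ A ]→ᴰ M′ →
                   ∃ λ m′ → (m —[ A ]→ᶜ m′) × R M′ m′
      wb-comm    : ∀ {M m M′ ℓ G γ} → R M m → M —[ ℓ ∶! G , γ ]→ M′ → R M′ m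
      wb-back    : ∀ {M m m′ A} → R M m → m —[ A ]→ᶜ m′ →
                   Σ DMon λ M₁ → Σ DMon λ M₂ → Σ DMon λ M′ →
                   (M ⇒c M₁) × (M₁ —[ A ]→ᴰ M₂) × (M₂ ⇒c M′) × R M′ m′

  DSynth : Set
  DSynth = LocEnv → Formula → Maybe DMon

module Submission where

-- Reading a violation off the centralized monitor suffices: by clauses (4) and (1) of the weak
-- bisimulation, every step of a rejecting run of 𝓜(φ) is matched by the decentralized monitor,
-- up to interleaved communication, and so is the final verdict no.  That 𝓜(φ) rejects every
-- T ∉ ⟦φ⟧ is proved contrapositively, by induction on φ: the traces on which a monitor never
-- rejects satisfy the formula it was synthesised from.  For max x.ψ the traces never rejected by
-- rec x.𝓜(ψ) form a post-fixed point of ψ; disjunctions and existentials are split with excluded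
-- middle.  Along the way every monitor reached is a substitution instance of a synthesised one,
-- and such monitors can always take a step that keeps their verdicts, so each operand of ⊗ and ⊕
-- can follow the other one.

open import Defs
open import Level using (0ℓ; Lift; lift; lower) renaming (suc to lsuc)
open import Function using (_∘_; id)
open import Data.Nat using (ℕ; zero; suc) renaming (_≟_ to _≟ℕ_)
open import Data.Fin using (Fin) renaming (_≟_ to _≟F_)
open import Data.Fin.Properties using (¬∀⟶∃¬)
open import Data.Bool using (T; not; if_then_else_)
open import Data.Maybe using (Maybe; just; nothing)
open import Data.Product using (∃; _×_; _,_; proj₂)
open import Data.Sum using (_⊎_; inj₁; inj₂; [_,_]′; map₂)
open import Data.Unit using (⊤) renaming (tt to ⋆)
open import Data.Empty using (⊥; ⊥-elim)
open import Data.List using (List; []; _∷_; foldl)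
open import Data.List.Relation.Unary.Any using (here; there; toSum)
open import Data.List.Membership.Propositional using (_∈_; _∉_)
open import Data.List.Membership.Propositional.Properties using (∈-filter⁺; ∈-allFin)
open import Relation.Nullary using (¬_; Dec) renaming (yes to yesᵈ; no to noᵈ)
open import Relation.Nullary.Decidable using (⌊_⌋; T?; decidable-stable; map′)
open import Relation.Binary.PropositionalEquality
  using (_≡_; _≢_; ≢-sym; refl; sym; trans; cong; cong₂; subst; module ≡-Reasoning)
open import Relation.Binary.Construct.Closure.ReflexiveTransitive using (ε; _◅_; _◅◅_; gmap)
open import Axiom.ExcludedMiddle using (ExcludedMiddle)

module _ {a} {A : Set a} {z x : ℕ} {p q : A} where

  if-≟-≡ : z ≡ x → (if ⌊ z ≟ℕ x ⌋ then p else q) ≡ p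
  if-≟-≡ z≡x with z ≟ℕ x
  ... | yesᵈ _ = refl
  ... | noᵈ z≢x = ⊥-elim (z≢x z≡x)

  if-≟-≢ : z ≢ x → (if ⌊ z ≟ℕ x ⌋ then p else q) ≡ q
  if-≟-≢ z≢x with z ≟ℕ x
  ... | yesᵈ z≡x = ⊥-elim (z≢x z≡x)
  ... | noᵈ _ = refl

module _ {P : Set} where

  Sub : Set
  Sub = ℕ → Maybe (Mon P)

  _[_≔_] : Sub → ℕ → Maybe (Mon P) → Sub
  (θ [ x ≔ o ]) z = if ⌊ z ≟ℕ x ⌋ then o else θ z

  lookupˢ : Maybe (Mon P) → ℕ → Mon P
  lookupˢ (just m) y = m
  lookupˢ nothing y = var y

  -- Binders are not renamed, so this avoids capture only when θ maps into closed monitors,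
  -- which is the case (AllBound Closed θ) wherever it matters below.
  sub : Sub → Mon P → Mon P
  sub θ ⌈ v ⌉ = ⌈ v ⌉
  sub θ (pre p m) = pre p (sub θ m)
  sub θ (m +ₘ n) = sub θ m +ₘ sub θ n
  sub θ (bin o m n) = bin o (sub θ m) (sub θ n)
  sub θ (rec y m) = rec y (sub (θ [ y ≔ nothing ]) m)
  sub θ (var y) = lookupˢ (θ y) y

  sub-var : ∀ θ {y k} → θ y ≡ just k → sub θ (var y) ≡ k
  sub-var θ θy≡k rewrite θy≡k = refl

  sub-cong : ∀ {θ θ′} → (∀ z → θ z ≡ θ′ z) → ∀ m → sub θ m ≡ sub θ′ m
  sub-cong θ≗θ′ ⌈ v ⌉ = refl
  sub-cong θ≗θ′ (pre p m) = cong (pre p) (sub-cong θ≗θ′ m)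
  sub-cong θ≗θ′ (m +ₘ n) = cong₂ _+ₘ_ (sub-cong θ≗θ′ m) (sub-cong θ≗θ′ n)
  sub-cong θ≗θ′ (bin o m n) = cong₂ (bin o) (sub-cong θ≗θ′ m) (sub-cong θ≗θ′ n)
  sub-cong {θ} {θ′} θ≗θ′ (rec y m) = cong (rec y) (sub-cong update-cong m)
    where
    update-cong : ∀ z → (θ [ y ≔ nothing ]) z ≡ (θ′ [ y ≔ nothing ]) z
    update-cong z with z ≟ℕ y
    ... | yesᵈ _ = refl
    ... | noᵈ _ = θ≗θ′ z
  sub-cong θ≗θ′ (var y) = cong (λ o → lookupˢ o y) (θ≗θ′ y)

  sub-id : ∀ m → sub (λ _ → nothing) m ≡ m
  sub-id ⌈ v ⌉ = refl
  sub-id (pre p m) = cong (pre p) (sub-id m)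
  sub-id (m +ₘ n) = cong₂ _+ₘ_ (sub-id m) (sub-id n)
  sub-id (bin o m n) = cong₂ (bin o) (sub-id m) (sub-id n)
  sub-id (rec y m) = cong (rec y) (trans (sub-cong empty m) (sub-id m))
    where
    empty : ∀ z → ((λ _ → nothing) [ y ≔ nothing ]) z ≡ nothing
    empty z with z ≟ℕ y
    ... | yesᵈ _ = refl
    ... | noᵈ _ = refl
  sub-id (var y) = refl

  AllFree : (ℕ → Set) → Mon P → Set
  AllFree Q ⌈ v ⌉ = ⊤
  AllFree Q (pre p m) = AllFree Q m
  AllFree Q (m +ₘ n) = AllFree Q m × AllFree Q n
  AllFree Q (bin o m n) = AllFree Q m × AllFree Q n
  AllFree Q (rec y m) = AllFree (λ z → z ≡ y ⊎ Q z) m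
  AllFree Q (var y) = Q y

  Closed : Mon P → Set
  Closed = AllFree (λ _ → ⊥)

  allFree-mono : ∀ {Q R : ℕ → Set} → (∀ {z} → Q z → R z) → ∀ m → AllFree Q m → AllFree R m
  allFree-mono Q⊆R ⌈ v ⌉ _ = ⋆
  allFree-mono Q⊆R (pre p m) f = allFree-mono Q⊆R m f
  allFree-mono Q⊆R (m +ₘ n) (f , g) = allFree-mono Q⊆R m f , allFree-mono Q⊆R n g
  allFree-mono Q⊆R (bin o m n) (f , g) = allFree-mono Q⊆R m f , allFree-mono Q⊆R n g
  allFree-mono Q⊆R (rec y m) f = allFree-mono (map₂ Q⊆R) m f
  allFree-mono Q⊆R (var y) f = Q⊆R f

  msubst-fresh : ∀ {Q} m x n → AllFree Q m → ¬ Q x → msubst m x n ≡ m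
  msubst-fresh ⌈ v ⌉ x n f ¬Qx = refl
  msubst-fresh (pre p m) x n f ¬Qx = cong (pre p) (msubst-fresh m x n f ¬Qx)
  msubst-fresh (m +ₘ m′) x n (f , g) ¬Qx =
    cong₂ _+ₘ_ (msubst-fresh m x n f ¬Qx) (msubst-fresh m′ x n g ¬Qx)
  msubst-fresh (bin o m m′) x n (f , g) ¬Qx =
    cong₂ (bin o) (msubst-fresh m x n f ¬Qx) (msubst-fresh m′ x n g ¬Qx)
  msubst-fresh (rec y m) x n f ¬Qx with y ≟ℕ x
  ... | yesᵈ _ = refl
  ... | noᵈ y≢x = cong (rec y) (msubst-fresh m x n f [ (≢-sym y≢x) , ¬Qx ]′)
  msubst-fresh (var y) x n f ¬Qx with y ≟ℕ x
  ... | yesᵈ refl = ⊥-elim (¬Qx f)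
  ... | noᵈ _ = refl

  Dom : Sub → ℕ → Set
  Dom θ y = ∃ λ k → θ y ≡ just k

  AllBound : (Mon P → Set) → Sub → Set
  AllBound Q θ = ∀ {y k} → θ y ≡ just k → Q k

  allBound-forget : ∀ {Q θ} x → AllBound Q θ → AllBound Q (θ [ x ≔ nothing ])
  allBound-forget x Qθ {y} e with y ≟ℕ x
  allBound-forget x Qθ () | yesᵈ _
  allBound-forget x Qθ e | noᵈ _ = Qθ e

  allBound-extend : ∀ {Q θ r} x → AllBound Q θ → Q r → AllBound Q (θ [ x ≔ just r ])
  allBound-extend x Qθ Qr {y} e with y ≟ℕ x
  allBound-extend x Qθ Qr refl | yesᵈ _ = Qr
  allBound-extend x Qθ Qr e | noᵈ _ = Qθ e

  sub-allFree : ∀ {Q θ} → AllBound Closed θ → ∀ m →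
                AllFree (λ z → Dom θ z ⊎ Q z) m → AllFree Q (sub θ m)
  sub-allFree closed ⌈ v ⌉ f = ⋆
  sub-allFree closed (pre p m) f = sub-allFree closed m f
  sub-allFree closed (m +ₘ n) (f , g) = sub-allFree closed m f , sub-allFree closed n g
  sub-allFree closed (bin o m n) (f , g) = sub-allFree closed m f , sub-allFree closed n g
  sub-allFree {Q} {θ} closed (rec y m) f =
    sub-allFree (allBound-forget {θ = θ} y closed) m (allFree-mono shift m f)
    where
    shift : ∀ {z} → z ≡ y ⊎ (Dom θ z ⊎ Q z) → Dom (θ [ y ≔ nothing ]) z ⊎ (z ≡ y ⊎ Q z)
    shift (inj₁ z≡y) = inj₂ (inj₁ z≡y)
    shift (inj₂ (inj₂ q)) = inj₂ (inj₂ q)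
    shift {z} (inj₂ (inj₁ bound)) with z ≟ℕ y
    ... | yesᵈ z≡y = inj₂ (inj₁ z≡y)
    ... | noᵈ _ = inj₁ bound
  sub-allFree closed (var y) (inj₁ (k , θy≡k)) rewrite θy≡k = allFree-mono ⊥-elim k (closed θy≡k)
  sub-allFree {θ = θ} closed (var y) (inj₂ q) with θ y in θy≡
  ... | just k = allFree-mono ⊥-elim k (closed θy≡)
  ... | nothing = q

  sub-closed : ∀ {θ} → AllBound Closed θ → ∀ m → AllFree (Dom θ) m → Closed (sub θ m)
  sub-closed closed m f = sub-allFree closed m (allFree-mono inj₁ m f)

  update-comm : ∀ θ {x y} (o o′ : Maybe (Mon P)) → x ≢ y →
                ∀ z → ((θ [ y ≔ o ]) [ x ≔ o′ ]) z ≡ ((θ [ x ≔ o′ ]) [ y ≔ o ]) z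
  update-comm θ {x} {y} o o′ x≢y z with z ≟ℕ x | z ≟ℕ y
  ... | yesᵈ refl | yesᵈ refl = ⊥-elim (x≢y refl)
  ... | yesᵈ _ | noᵈ _ = refl
  ... | noᵈ _ | yesᵈ _ = refl
  ... | noᵈ _ | noᵈ _ = refl

  update-overwrite : ∀ θ x (o o′ : Maybe (Mon P)) z →
                     ((θ [ x ≔ o ]) [ x ≔ o′ ]) z ≡ (θ [ x ≔ o′ ]) z
  update-overwrite θ x o o′ z with z ≟ℕ x
  ... | yesᵈ _ = refl
  ... | noᵈ _ = refl

  msubst-sub : ∀ {θ} m x n → θ x ≡ nothing → AllBound Closed θ →
               msubst (sub θ m) x n ≡ sub (θ [ x ≔ just n ]) m
  msubst-sub ⌈ v ⌉ x n θx≡ closed = refl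
  msubst-sub (pre p m) x n θx≡ closed = cong (pre p) (msubst-sub m x n θx≡ closed)
  msubst-sub (m +ₘ m′) x n θx≡ closed =
    cong₂ _+ₘ_ (msubst-sub m x n θx≡ closed) (msubst-sub m′ x n θx≡ closed)
  msubst-sub (bin o m m′) x n θx≡ closed =
    cong₂ (bin o) (msubst-sub m x n θx≡ closed) (msubst-sub m′ x n θx≡ closed)
  msubst-sub {θ} (rec y m) x n θx≡ closed with y ≟ℕ x
  ... | yesᵈ refl = cong (rec y) (sub-cong (λ z → sym (update-overwrite θ y (just n) nothing z)) m)
  ... | noᵈ y≢x = cong (rec y) (begin
    msubst (sub (θ [ y ≔ nothing ]) m) x n
      ≡⟨ msubst-sub m x n (trans (if-≟-≢ (≢-sym y≢x)) θx≡) (allBound-forget {θ = θ} y closed) ⟩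
    sub ((θ [ y ≔ nothing ]) [ x ≔ just n ]) m
      ≡⟨ sub-cong (update-comm θ nothing (just n) (≢-sym y≢x)) m ⟩
    sub ((θ [ x ≔ just n ]) [ y ≔ nothing ]) m ∎)
    where open ≡-Reasoning
  msubst-sub {θ} (var y) x n θx≡ closed with θ y in θy≡
  ... | just k with y ≟ℕ x
  ...   | yesᵈ refl with () ← trans (sym θx≡) θy≡
  ...   | noᵈ _ = msubst-fresh k x n (closed θy≡) (λ ())
  msubst-sub {θ} (var y) x n θx≡ closed | nothing with y ≟ℕ x
  ...   | yesᵈ _ = refl
  ...   | noᵈ _ = refl

  unfold-sub : ∀ {θ} x m → AllBound Closed θ →
               unfold x (sub (θ [ x ≔ nothing ]) m) ≡ sub (θ [ x ≔ just (sub θ (rec x m)) ]) m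
  unfold-sub {θ} x m closed =
    trans (msubst-sub m x _ (if-≟-≡ {z = x} refl) (allBound-forget {θ = θ} x closed))
          (sub-cong (update-overwrite θ x nothing _) m)

  _⇛⊆_ : Mon P → Mon P → Set
  m ⇛⊆ m′ = ∀ {v} → m ⇛ v → m′ ⇛ v

  ⇛⊆-bin : ∀ {o m m′ n n′} → m ⇛⊆ m′ → n ⇛⊆ n′ → bin o m n ⇛⊆ bin o m′ n′
  ⇛⊆-bin m⊆ n⊆ (ev-end p q) = ev-end (m⊆ p) (n⊆ q)
  ⇛⊆-bin m⊆ n⊆ (ev-⊕yesL p) = ev-⊕yesL (m⊆ p)
  ⇛⊆-bin m⊆ n⊆ (ev-⊕yesR p) = ev-⊕yesR (n⊆ p)
  ⇛⊆-bin m⊆ n⊆ (ev-⊗noL p) = ev-⊗noL (m⊆ p)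
  ⇛⊆-bin m⊆ n⊆ (ev-⊗noR p) = ev-⊗noR (n⊆ p)
  ⇛⊆-bin m⊆ n⊆ (ev-⊕noL p q) = ev-⊕noL (m⊆ p) (n⊆ q)
  ⇛⊆-bin m⊆ n⊆ (ev-⊕noR p q) = ev-⊕noR (n⊆ p) (m⊆ q)
  ⇛⊆-bin m⊆ n⊆ (ev-⊗yesL p q) = ev-⊗yesL (m⊆ p) (n⊆ q)
  ⇛⊆-bin m⊆ n⊆ (ev-⊗yesR p q) = ev-⊗yesR (n⊆ p) (m⊆ q)

module Completeness (nA′ nL′ nC : ℕ) where
  open Model nA′ nL′ nC

  CSub : Set
  CSub = Sub {Act × Loc}

  ∈-others : ∀ {a b} → b ≢ a → b ∈ others a
  ∈-others {a} {b} b≢a = ∈-filter⁺ (T? ∘ λ c → not ⌊ c ≟F a ⌋) (∈-allFin b) b-kept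
    where
    b-kept : T (not ⌊ b ≟F a ⌋)
    b-kept with b ≟F a
    ... | yesᵈ b≡a = b≢a b≡a
    ... | noᵈ _ = ⋆

  -- modal a ℓ m v is definitionally foldl (branch ℓ v) (pre (a , ℓ) m) (others a).
  branch : Loc → Verdict → CMon → Act → CMon
  branch ℓ v acc b = acc +ₘ pre (b , ℓ) ⌈ v ⌉

  module _ {ℓ : Loc} {v : Verdict} where

    foldl-branch-step : ∀ {acc m′ A} bs → acc —[ A ]→ᶜ m′ → foldl (branch ℓ v) acc bs —[ A ]→ᶜ m′
    foldl-branch-step [] s = s
    foldl-branch-step (b ∷ bs) s = foldl-branch-step bs (c-+L s)

    foldl-branch-verdict : ∀ {acc A b} bs → b ∈ bs → A ℓ ≡ b →
                           foldl (branch ℓ v) acc bs —[ A ]→ᶜ ⌈ v ⌉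
    foldl-branch-verdict (_ ∷ bs) (here refl) Aℓ≡b = foldl-branch-step bs (c-+R (c-pre Aℓ≡b))
    foldl-branch-verdict (_ ∷ bs) (there b∈bs) Aℓ≡b = foldl-branch-verdict bs b∈bs Aℓ≡b

    foldl-branch-silent : ∀ {acc u} bs → (∀ {w} → ¬ acc ⇛ w) → ¬ foldl (branch ℓ v) acc bs ⇛ u
    foldl-branch-silent [] silent = silent
    foldl-branch-silent {acc} (b ∷ bs) silent = foldl-branch-silent bs branch-silent
      where
      branch-silent : ∀ {w} → ¬ branch ℓ v acc b ⇛ w
      branch-silent (ev-+L p) = silent p
      branch-silent (ev-+R ())

    sub-foldl-branch : ∀ θ acc bs →
                       sub θ (foldl (branch ℓ v) acc bs) ≡ foldl (branch ℓ v) (sub θ acc) bs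
    sub-foldl-branch θ acc [] = refl
    sub-foldl-branch θ acc (b ∷ bs) = sub-foldl-branch θ (branch ℓ v acc b) bs

    allFree-foldl-branch : ∀ {Q acc} bs → AllFree Q acc → AllFree Q (foldl (branch ℓ v) acc bs)
    allFree-foldl-branch [] f = f
    allFree-foldl-branch (b ∷ bs) f = allFree-foldl-branch bs (f , ⋆)

  module _ (a : Act) (ℓ : Loc) {m : CMon} {v : Verdict} where

    modal-step : ∀ {A} → A ℓ ≡ a → modal a ℓ m v —[ A ]→ᶜ m
    modal-step Aℓ≡a = foldl-branch-step (others a) (c-pre Aℓ≡a)

    modal-step-end : ∀ {A} → A ℓ ≢ a → modal a ℓ m v —[ A ]→ᶜ ⌈ end ⌉
    modal-step-end Aℓ≢a = foldl-branch-step (others a) (c-preE Aℓ≢a)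

    modal-step-verdict : ∀ {A} → A ℓ ≢ a → modal a ℓ m v —[ A ]→ᶜ ⌈ v ⌉
    modal-step-verdict Aℓ≢a = foldl-branch-verdict (others a) (∈-others Aℓ≢a) refl

    modal-silent : ∀ {u} → ¬ modal a ℓ m v ⇛ u
    modal-silent = foldl-branch-silent (others a) λ ()

    sub-modal : ∀ θ → sub θ (modal a ℓ m v) ≡ modal a ℓ (sub θ m) v
    sub-modal θ = sub-foldl-branch θ (pre (a , ℓ) m) (others a)

    allFree-modal : ∀ {Q} → AllFree Q m → AllFree Q (modal a ℓ m v)
    allFree-modal = allFree-foldl-branch (others a)

  bigOp-closed : ∀ (Q : CMon → Set) o → (∀ {m n} → Q m → Q n → Q (bin o m n)) →
                 ∀ {n} {g : Fin (suc n) → CMon} → (∀ i → Q (g i)) → Q (bigOp o g)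
  bigOp-closed Q o Q-bin {zero} Qg = Qg Fin.zero
  bigOp-closed Q o Q-bin {suc n} Qg = Q-bin (Qg Fin.zero) (bigOp-closed Q o Q-bin (Qg ∘ Fin.suc))

  sub-bigOp : ∀ θ o {n} (g : Fin (suc n) → CMon) → sub θ (bigOp o g) ≡ bigOp o (sub θ ∘ g)
  sub-bigOp θ o {zero} g = refl
  sub-bigOp θ o {suc n} g rewrite sub-bigOp θ o (g ∘ Fin.suc) = refl

  𝓜-=ₗ-verdict : ∀ σ π π′ → ∃ λ v → 𝓜 σ (π =ₗ π′) ≡ ⌈ v ⌉
  𝓜-=ₗ-verdict σ π π′ with σ π | σ π′
  ... | nothing | _ = end , refl
  ... | just _ | nothing = end , refl
  ... | just ℓ | just ℓ′ with ℓ ≟F ℓ′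
  ...   | yesᵈ _ = yes , refl
  ...   | noᵈ _ = no , refl

  𝓜-≠ₗ-verdict : ∀ σ π π′ → ∃ λ v → 𝓜 σ (π ≠ₗ π′) ≡ ⌈ v ⌉
  𝓜-≠ₗ-verdict σ π π′ with σ π | σ π′
  ... | nothing | _ = end , refl
  ... | just _ | nothing = end , refl
  ... | just ℓ | just ℓ′ with ℓ ≟F ℓ′
  ...   | yesᵈ _ = no , refl
  ...   | noᵈ _ = yes , refl

  allFree-𝓜 : ∀ σ ψ {Ps Xs} → ClosedIn Ps Xs ψ → AllFree (_∈ Xs) (𝓜 σ ψ)
  allFree-𝓜 σ tt c = ⋆
  allFree-𝓜 σ ff c = ⋆
  allFree-𝓜 σ (ψ₁ ∧ ψ₂) (c₁ , c₂) = allFree-𝓜 σ ψ₁ c₁ , allFree-𝓜 σ ψ₂ c₂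
  allFree-𝓜 σ (ψ₁ ∨ ψ₂) (c₁ , c₂) = allFree-𝓜 σ ψ₁ c₁ , allFree-𝓜 σ ψ₂ c₂
  allFree-𝓜 σ (max x ψ) c = allFree-mono toSum (𝓜 σ ψ) (allFree-𝓜 σ ψ c)
  allFree-𝓜 σ (min x ψ) c = ⋆
  allFree-𝓜 σ (rvar x) c = c
  allFree-𝓜 σ (ex π ψ) c = bigOp-closed (AllFree _) ⊕ _,_ (λ ℓ → allFree-𝓜 (σ [ π ↦ ℓ ]) ψ c)
  allFree-𝓜 σ (all π ψ) c = bigOp-closed (AllFree _) ⊗ _,_ (λ ℓ → allFree-𝓜 (σ [ π ↦ ℓ ]) ψ c)
  allFree-𝓜 σ (π =ₗ π′) c = subst (AllFree _) (sym (proj₂ (𝓜-=ₗ-verdict σ π π′))) ⋆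
  allFree-𝓜 σ (π ≠ₗ π′) c = subst (AllFree _) (sym (proj₂ (𝓜-≠ₗ-verdict σ π π′))) ⋆
  allFree-𝓜 σ ([ a at π ] ψ) (_ , c) with σ π
  ... | nothing = ⋆
  ... | just ℓ = allFree-modal a ℓ (allFree-𝓜 σ ψ c)
  allFree-𝓜 σ (⟨ a at π ⟩ ψ) (_ , c) with σ π
  ... | nothing = ⋆
  ... | just ℓ = allFree-modal a ℓ (allFree-𝓜 σ ψ c)

  -- The monitors met along a run of 𝓜 σ∅ φ: the recursion variables of a subformula ψ are
  -- replaced by the unfoldings of their enclosing max-formulas.
  mutual

    data Synth : CMon → Set where
      synth-verdict : ∀ {v} → Synth ⌈ v ⌉
      synth-bin     : ∀ {o m n} → Synth m → Synth n → Synth (bin o m n)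
      synth-𝓜       : ∀ {U Ps Xs θ} σ ψ → Guarded U ψ → ClosedIn Ps Xs ψ → Admissible Xs θ →
                      Synth (sub θ (𝓜 σ ψ))

    record Admissible (Xs : List ℕ) (θ : CSub) : Set where
      inductive
      field
        defined : ∀ {y} → y ∈ Xs → Dom θ y
        closed  : AllBound Closed θ
        synth   : AllBound Synth θ

  open Admissible

  admissible-extend : ∀ {Xs θ r} x → Admissible Xs θ → Closed r → Synth r →
                      Admissible (x ∷ Xs) (θ [ x ≔ just r ])
  admissible-extend {Xs} {θ} {r} x adm closed-r synth-r = record
    { defined = defined′
    ; closed  = allBound-extend {θ = θ} x (closed adm) closed-r
    ; synth   = allBound-extend {θ = θ} x (synth adm) synth-r
    }
    where
    defined′ : ∀ {y} → y ∈ x ∷ Xs → Dom (θ [ x ≔ just r ]) y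
    defined′ (here y≡x) = r , if-≟-≡ y≡x
    defined′ {y} (there y∈Xs) with y ≟ℕ x
    ... | yesᵈ _ = r , refl
    ... | noᵈ _ = defined adm y∈Xs

  sub-𝓜-closed : ∀ {Ps Xs θ} σ ψ → Admissible Xs θ → ClosedIn Ps Xs ψ → Closed (sub θ (𝓜 σ ψ))
  sub-𝓜-closed σ ψ adm c =
    sub-closed (closed adm) (𝓜 σ ψ) (allFree-mono (defined adm) (𝓜 σ ψ) (allFree-𝓜 σ ψ c))

  admissible-unfold : ∀ {U Ps Xs θ} σ x ψ → Guarded U (max x ψ) → ClosedIn Ps Xs (max x ψ) →
                      Admissible Xs θ → Admissible (x ∷ Xs) (θ [ x ≔ just (sub θ (𝓜 σ (max x ψ))) ])
  admissible-unfold σ x ψ g c adm =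
    admissible-extend x adm (sub-𝓜-closed σ (max x ψ) adm c) (synth-𝓜 σ (max x ψ) g c adm)

  Successor : CMon → (Loc → Act) → Set
  Successor m A = ∃ λ m′ → (m —[ A ]→ᶜ m′) × Synth m′ × m ⇛⊆ m′

  successor-verdict : ∀ {v A} → Successor ⌈ v ⌉ A
  successor-verdict = _ , c-verd , synth-verdict , id

  successor-bin : ∀ {o m n A} → Successor m A → Successor n A → Successor (bin o m n) A
  successor-bin (m′ , m→ , sm , m⊆) (n′ , n→ , sn , n⊆) =
    bin _ m′ n′ , c-bin m→ n→ , synth-bin sm sn , ⇛⊆-bin m⊆ n⊆

  successor-rec : ∀ {x m A} → Successor (unfold x m) A → Successor (rec x m) A
  successor-rec (m′ , m→ , sm , m⊆) = m′ , c-rec m→ , sm , λ { (ev-rec p) → m⊆ p }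

  successor-modal : ∀ a ℓ {m v A} → Synth m → Successor (modal a ℓ m v) A
  successor-modal a ℓ {A = A} sm with A ℓ ≟F a
  ... | yesᵈ Aℓ≡a = _ , modal-step a ℓ Aℓ≡a , sm , ⊥-elim ∘ modal-silent a ℓ
  ... | noᵈ Aℓ≢a = _ , modal-step-end a ℓ Aℓ≢a , synth-verdict , ⊥-elim ∘ modal-silent a ℓ

  -- Guardedness makes this terminate: the variable unfolded at a max is put in U, so it is only
  -- met again under a modality, where the monitor stops instead of unfolding it.
  successor-𝓜 : ∀ {A U Ps Xs θ} σ ψ → Guarded U ψ → ClosedIn Ps Xs ψ → Admissible Xs θ →
                (∀ {y k} → y ∉ U → θ y ≡ just k → Successor k A) → Successor (sub θ (𝓜 σ ψ)) A
  successor-𝓜 σ tt g c adm next = successor-verdict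
  successor-𝓜 σ ff g c adm next = successor-verdict
  successor-𝓜 σ (ψ₁ ∧ ψ₂) (g₁ , g₂) (c₁ , c₂) adm next =
    successor-bin (successor-𝓜 σ ψ₁ g₁ c₁ adm next) (successor-𝓜 σ ψ₂ g₂ c₂ adm next)
  successor-𝓜 σ (ψ₁ ∨ ψ₂) (g₁ , g₂) (c₁ , c₂) adm next =
    successor-bin (successor-𝓜 σ ψ₁ g₁ c₁ adm next) (successor-𝓜 σ ψ₂ g₂ c₂ adm next)
  successor-𝓜 {A} {θ = θ} σ (max x ψ) g c adm next =
    successor-rec (subst (λ m → Successor m A) (sym (unfold-sub x (𝓜 σ ψ) (closed adm)))
      (successor-𝓜 σ ψ g c (admissible-unfold σ x ψ g c adm) next′))
    where
    next′ : ∀ {y k} → y ∉ x ∷ _ → (θ [ x ≔ just _ ]) y ≡ just k → Successor k A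
    next′ y∉ θ′y≡k = next (y∉ ∘ there) (trans (sym (if-≟-≢ (y∉ ∘ here))) θ′y≡k)
  successor-𝓜 σ (min x ψ) g c adm next = successor-verdict
  successor-𝓜 {A} {θ = θ} σ (rvar y) g c adm next with defined adm c
  ... | k , θy≡k = subst (λ m → Successor m A) (sym (sub-var θ θy≡k)) (next g θy≡k)
  successor-𝓜 {A} {θ = θ} σ (ex π ψ) g c adm next =
    subst (λ m → Successor m A) (sym (sub-bigOp θ ⊕ λ ℓ → 𝓜 (σ [ π ↦ ℓ ]) ψ))
      (bigOp-closed (λ m → Successor m A) ⊕ successor-bin
        (λ ℓ → successor-𝓜 (σ [ π ↦ ℓ ]) ψ g c adm next))
  successor-𝓜 {A} {θ = θ} σ (all π ψ) g c adm next =
    subst (λ m → Successor m A) (sym (sub-bigOp θ ⊗ λ ℓ → 𝓜 (σ [ π ↦ ℓ ]) ψ))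
      (bigOp-closed (λ m → Successor m A) ⊗ successor-bin
        (λ ℓ → successor-𝓜 (σ [ π ↦ ℓ ]) ψ g c adm next))
  successor-𝓜 {A} {θ = θ} σ (π =ₗ π′) g c adm next =
    subst (λ m → Successor (sub θ m) A) (sym (proj₂ (𝓜-=ₗ-verdict σ π π′))) successor-verdict
  successor-𝓜 {A} {θ = θ} σ (π ≠ₗ π′) g c adm next =
    subst (λ m → Successor (sub θ m) A) (sym (proj₂ (𝓜-≠ₗ-verdict σ π π′))) successor-verdict
  successor-𝓜 {A} {θ = θ} σ ([ a at π ] ψ) g (_ , c) adm next with σ π
  ... | nothing = successor-verdict
  ... | just ℓ = subst (λ m → Successor m A) (sym (sub-modal a ℓ θ))
                   (successor-modal a ℓ (synth-𝓜 σ ψ g c adm))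
  successor-𝓜 {A} {θ = θ} σ (⟨ a at π ⟩ ψ) g (_ , c) adm next with σ π
  ... | nothing = successor-verdict
  ... | just ℓ = subst (λ m → Successor m A) (sym (sub-modal a ℓ θ))
                   (successor-modal a ℓ (synth-𝓜 σ ψ g c adm))

  successor : ∀ {m} → Synth m → ∀ A → Successor m A
  successor synth-verdict A = successor-verdict
  successor (synth-bin sm sn) A = successor-bin (successor sm A) (successor sn A)
  successor (synth-𝓜 σ ψ g c adm) A =
    successor-𝓜 σ ψ g c adm (λ _ θy≡k → successor (synth adm θy≡k) A)

  -- Recording Synth along the run lets the other operand of ⊗ or ⊕ keep pace (rejects-⊗ˡ, …).
  data Rejects : CMon → HTrc → Set where
    now  : ∀ {m T} → m ⇛ no → Rejects m T
    step : ∀ {m m′ T} → m —[ hd T ]→ᶜ m′ → Synth m′ → Rejects m′ (tl T) → Rejects m T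

  rejects-⊗ˡ : ∀ {m n T} → Synth n → Rejects m T → Rejects (bin ⊗ m n) T
  rejects-⊗ˡ sn (now m⇛no) = now (ev-⊗noL m⇛no)
  rejects-⊗ˡ {T = T} sn (step m→ sm′ r) with successor sn (hd T)
  ... | _ , n→ , sn′ , _ = step (c-bin m→ n→) (synth-bin sm′ sn′) (rejects-⊗ˡ sn′ r)

  rejects-⊗ʳ : ∀ {m n T} → Synth m → Rejects n T → Rejects (bin ⊗ m n) T
  rejects-⊗ʳ sm (now n⇛no) = now (ev-⊗noR n⇛no)
  rejects-⊗ʳ {T = T} sm (step n→ sn′ r) with successor sm (hd T)
  ... | _ , m→ , sm′ , _ = step (c-bin m→ n→) (synth-bin sm′ sn′) (rejects-⊗ʳ sm′ r)

  rejects-⊕-nowˡ : ∀ {m n T} → Synth m → m ⇛ no → Rejects n T → Rejects (bin ⊕ m n) T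
  rejects-⊕-nowˡ sm m⇛no (now n⇛no) = now (ev-⊕noL m⇛no n⇛no)
  rejects-⊕-nowˡ {T = T} sm m⇛no (step n→ sn′ r) with successor sm (hd T)
  ... | _ , m→ , sm′ , m⊆ = step (c-bin m→ n→) (synth-bin sm′ sn′) (rejects-⊕-nowˡ sm′ (m⊆ m⇛no) r)

  rejects-⊕-nowʳ : ∀ {m n T} → Synth n → n ⇛ no → Rejects m T → Rejects (bin ⊕ m n) T
  rejects-⊕-nowʳ sn n⇛no (now m⇛no) = now (ev-⊕noL m⇛no n⇛no)
  rejects-⊕-nowʳ {T = T} sn n⇛no (step m→ sm′ r) with successor sn (hd T)
  ... | _ , n→ , sn′ , n⊆ = step (c-bin m→ n→) (synth-bin sm′ sn′) (rejects-⊕-nowʳ sn′ (n⊆ n⇛no) r)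

  rejects-⊕ : ∀ {m n T} → Synth m → Synth n → Rejects m T → Rejects n T → Rejects (bin ⊕ m n) T
  rejects-⊕ sm sn (now m⇛no) rn = rejects-⊕-nowˡ sm m⇛no rn
  rejects-⊕ sm sn rm (now n⇛no) = rejects-⊕-nowʳ sn n⇛no rm
  rejects-⊕ sm sn (step m→ sm′ rm) (step n→ sn′ rn) =
    step (c-bin m→ n→) (synth-bin sm′ sn′) (rejects-⊕ sm′ sn′ rm rn)

  rejects-⨂ : ∀ {n T} {g : Fin (suc n) → CMon} → (∀ i → Synth (g i)) → ∀ i → Rejects (g i) T →
              Rejects (bigOp ⊗ g) T
  rejects-⨂ {zero} sg Fin.zero r = r
  rejects-⨂ {suc n} sg Fin.zero r = rejects-⊗ˡ (bigOp-closed Synth ⊗ synth-bin (sg ∘ Fin.suc)) r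
  rejects-⨂ {suc n} sg (Fin.suc i) r = rejects-⊗ʳ (sg Fin.zero) (rejects-⨂ (sg ∘ Fin.suc) i r)

  rejects-⨁ : ∀ {n T} {g : Fin (suc n) → CMon} → (∀ i → Synth (g i)) → (∀ i → Rejects (g i) T) →
              Rejects (bigOp ⊕ g) T
  rejects-⨁ {zero} sg r = r Fin.zero
  rejects-⨁ {suc n} sg r =
    rejects-⊕ (sg Fin.zero) (bigOp-closed Synth ⊕ synth-bin (sg ∘ Fin.suc)) (r Fin.zero)
              (rejects-⨁ (sg ∘ Fin.suc) (r ∘ Fin.suc))

  rejects-rec : ∀ {x m T} → Rejects (unfold x m) T → Rejects (rec x m) T
  rejects-rec (now m⇛no) = now (ev-rec m⇛no)
  rejects-rec (step m→ sm′ r) = step (c-rec m→) sm′ r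

  rejects-sub-rec : ∀ θ x m {T} → AllBound Closed θ →
                    Rejects (sub (θ [ x ≔ just (sub θ (rec x m)) ]) m) T → Rejects (sub θ (rec x m)) T
  rejects-sub-rec θ x m closed =
    rejects-rec ∘ subst (λ m′ → Rejects m′ _) (sym (unfold-sub x m closed))

  rejects-sub-⨂ : ∀ θ {n T} (g : Fin (suc n) → CMon) → (∀ i → Synth (sub θ (g i))) →
                  ∀ i → Rejects (sub θ (g i)) T → Rejects (sub θ (bigOp ⊗ g)) T
  rejects-sub-⨂ θ g sg i r rewrite sub-bigOp θ ⊗ g = rejects-⨂ sg i r

  rejects-sub-⨁ : ∀ θ {n T} (g : Fin (suc n) → CMon) → (∀ i → Synth (sub θ (g i))) →
                  (∀ i → Rejects (sub θ (g i)) T) → Rejects (sub θ (bigOp ⊕ g)) T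
  rejects-sub-⨁ θ g sg r rewrite sub-bigOp θ ⊕ g = rejects-⨁ sg r

  rejects-sub-modal : ∀ θ a ℓ {m v T} → hd T ℓ ≡ a → Synth (sub θ m) → Rejects (sub θ m) (tl T) →
                      Rejects (sub θ (modal a ℓ m v)) T
  rejects-sub-modal θ a ℓ {m} {v} hdℓ≡a sm r rewrite sub-modal a ℓ {m} {v} θ =
    step (modal-step a ℓ hdℓ≡a) sm r

  rejects-sub-diamond : ∀ θ a ℓ {m T} → hd T ℓ ≢ a → Rejects (sub θ (modal a ℓ m no)) T
  rejects-sub-diamond θ a ℓ {m} hdℓ≢a rewrite sub-modal a ℓ {m} {no} θ =
    step (modal-step-verdict a ℓ hdℓ≢a) synth-verdict (now ev-verd)

  DefinedOn : List ℕ → LocEnv → Set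
  DefinedOn Ps σ = ∀ {π} → π ∈ Ps → ∃ λ ℓ → σ π ≡ just ℓ

  definedOn-extend : ∀ {Ps σ} π ℓ → DefinedOn Ps σ → DefinedOn (π ∷ Ps) (σ [ π ↦ ℓ ])
  definedOn-extend π ℓ dσ (here π′≡π) = ℓ , if-≟-≡ π′≡π
  definedOn-extend π ℓ dσ {π′} (there π′∈Ps) with π′ ≟ℕ π
  ... | yesᵈ _ = ℓ , refl
  ... | noᵈ _ = dσ π′∈Ps

  NeverRejects : CMon → HSet
  NeverRejects m T = ¬ Rejects m T

  Covers : List ℕ → CSub → RecEnv → Set
  Covers Xs θ ρ = ∀ {y k} → y ∈ Xs → θ y ≡ just k → ∀ T → NeverRejects k T → ρ y T

  covers-extend : ∀ {Xs θ ρ} x r → Covers Xs θ ρ →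
                  Covers (x ∷ Xs) (θ [ x ≔ just r ]) (ρ [ x ↦ᵣ NeverRejects r ])
  covers-extend x r cov {y} y∈ θ′y≡k T ok with y ≟ℕ x
  covers-extend x r cov y∈ refl T ok | yesᵈ _ = ok
  covers-extend x r cov (here y≡x) θ′y≡k T ok | noᵈ y≢x = ⊥-elim (y≢x y≡x)
  covers-extend x r cov (there y∈Xs) θ′y≡k T ok | noᵈ _ = cov y∈Xs θ′y≡k T ok

  sat-=ₗ : ∀ {Ps ρ T} θ σ π π′ → π ∈ Ps → π′ ∈ Ps → DefinedOn Ps σ →
           NeverRejects (sub θ (𝓜 σ (π =ₗ π′))) T → ⟦ π =ₗ π′ ⟧ ρ σ T
  sat-=ₗ θ σ π π′ π∈ π′∈ dσ ok with σ π | σ π′ | dσ π∈ | dσ π′∈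
  ... | nothing | _ | _ , () | _
  ... | just _ | nothing | _ | _ , ()
  ... | just ℓ | just ℓ′ | _ | _ with ℓ ≟F ℓ′
  ...   | yesᵈ ℓ≡ℓ′ = lift ℓ≡ℓ′
  ...   | noᵈ _ = ⊥-elim (ok (now ev-verd))

  sat-≠ₗ : ∀ {Ps ρ T} θ σ π π′ → π ∈ Ps → π′ ∈ Ps → DefinedOn Ps σ →
           NeverRejects (sub θ (𝓜 σ (π ≠ₗ π′))) T → ⟦ π ≠ₗ π′ ⟧ ρ σ T
  sat-≠ₗ θ σ π π′ π∈ π′∈ dσ ok with σ π | σ π′ | dσ π∈ | dσ π′∈
  ... | nothing | _ | _ , () | _
  ... | just _ | nothing | _ | _ , ()
  ... | just ℓ | just ℓ′ | _ | _ with ℓ ≟F ℓ′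
  ...   | yesᵈ _ = ⊥-elim (ok (now ev-verd))
  ...   | noᵈ ℓ≢ℓ′ = lift ℓ≢ℓ′

  module _ (rejects? : ∀ m T → Dec (Rejects m T)) where

    sat-if-neverRejects : ∀ {U Ps Xs ρ θ} σ ψ → Guarded U ψ → ClosedIn Ps Xs ψ → MinFree ψ →
                          DefinedOn Ps σ → Admissible Xs θ → Covers Xs θ ρ →
                          ∀ T → NeverRejects (sub θ (𝓜 σ ψ)) T → ⟦ ψ ⟧ ρ σ T
    sat-if-neverRejects σ tt g c mf dσ adm cov T ok = lift ⋆
    sat-if-neverRejects σ ff g c mf dσ adm cov T ok = ⊥-elim (ok (now ev-verd))
    sat-if-neverRejects σ (ψ₁ ∧ ψ₂) (g₁ , g₂) (c₁ , c₂) (mf₁ , mf₂) dσ adm cov T ok =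
      sat-if-neverRejects σ ψ₁ g₁ c₁ mf₁ dσ adm cov T (ok ∘ rejects-⊗ˡ (synth-𝓜 σ ψ₂ g₂ c₂ adm)) ,
      sat-if-neverRejects σ ψ₂ g₂ c₂ mf₂ dσ adm cov T (ok ∘ rejects-⊗ʳ (synth-𝓜 σ ψ₁ g₁ c₁ adm))
    sat-if-neverRejects {θ = θ} σ (ψ₁ ∨ ψ₂) (g₁ , g₂) (c₁ , c₂) (mf₁ , mf₂) dσ adm cov T ok
      with rejects? (sub θ (𝓜 σ ψ₁)) T
    ... | noᵈ ok₁ = inj₁ (sat-if-neverRejects σ ψ₁ g₁ c₁ mf₁ dσ adm cov T ok₁)
    ... | yesᵈ r₁ = inj₂ (sat-if-neverRejects σ ψ₂ g₂ c₂ mf₂ dσ adm cov T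
                     (ok ∘ rejects-⊕ (synth-𝓜 σ ψ₁ g₁ c₁ adm) (synth-𝓜 σ ψ₂ g₂ c₂ adm) r₁))
    sat-if-neverRejects {θ = θ} σ (max x ψ) g c mf dσ adm cov T ok =
      -- The traces never rejected by the unfolding monitor r form a post-fixed point of ψ.
      NeverRejects r ,
      (λ T′ ok′ → sat-if-neverRejects σ ψ g c mf dσ (admissible-unfold σ x ψ g c adm)
                    (covers-extend x r cov) T′ (ok′ ∘ rejects-sub-rec θ x (𝓜 σ ψ) (closed adm))) ,
      ok
      where
      r : CMon
      r = sub θ (𝓜 σ (max x ψ))
    sat-if-neverRejects {θ = θ} σ (rvar y) g c mf dσ adm cov T ok with defined adm c
    ... | k , θy≡k = lift (cov c θy≡k T (ok ∘ subst (λ m → Rejects m T) (sym (sub-var θ θy≡k))))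
    sat-if-neverRejects {θ = θ} σ (ex π ψ) g c mf dσ adm cov T ok =
      let ℓ , okℓ = ¬∀⟶∃¬ _ (λ ℓ → Rejects (sub θ (𝓜ₗ ℓ)) T) (λ ℓ → rejects? (sub θ (𝓜ₗ ℓ)) T)
                      (ok ∘ rejects-sub-⨁ θ 𝓜ₗ λ ℓ → synth-𝓜 (σ [ π ↦ ℓ ]) ψ g c adm)
      in ℓ , sat-if-neverRejects (σ [ π ↦ ℓ ]) ψ g c mf (definedOn-extend π ℓ dσ) adm cov T okℓ
      where
      𝓜ₗ : Loc → CMon
      𝓜ₗ ℓ = 𝓜 (σ [ π ↦ ℓ ]) ψ
    sat-if-neverRejects {θ = θ} σ (all π ψ) g c mf dσ adm cov T ok ℓ =
      sat-if-neverRejects (σ [ π ↦ ℓ ]) ψ g c mf (definedOn-extend π ℓ dσ) adm cov T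
        (ok ∘ rejects-sub-⨂ θ (λ ℓ → 𝓜 (σ [ π ↦ ℓ ]) ψ) (λ ℓ → synth-𝓜 (σ [ π ↦ ℓ ]) ψ g c adm) ℓ)
    sat-if-neverRejects {ρ = ρ} {θ} σ (π =ₗ π′) g (π∈ , π′∈) mf dσ adm cov T ok =
      sat-=ₗ {ρ = ρ} θ σ π π′ π∈ π′∈ dσ ok
    sat-if-neverRejects {ρ = ρ} {θ} σ (π ≠ₗ π′) g (π∈ , π′∈) mf dσ adm cov T ok =
      sat-≠ₗ {ρ = ρ} θ σ π π′ π∈ π′∈ dσ ok
    sat-if-neverRejects {θ = θ} σ ([ a at π ] ψ) g (π∈ , c) mf dσ adm cov T ok with σ π | dσ π∈
    ... | nothing | _ , ()
    ... | just ℓ | _ = λ hdℓ≡a → sat-if-neverRejects σ ψ g c mf dσ adm cov (tl T)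
                                   (ok ∘ rejects-sub-modal θ a ℓ hdℓ≡a (synth-𝓜 σ ψ g c adm))
    sat-if-neverRejects {θ = θ} σ (⟨ a at π ⟩ ψ) g (π∈ , c) mf dσ adm cov T ok with σ π | dσ π∈
    ... | nothing | _ , ()
    ... | just ℓ | _ with hd T ℓ ≟F a
    ...   | yesᵈ hdℓ≡a = hdℓ≡a , sat-if-neverRejects σ ψ g c mf dσ adm cov (tl T)
                                   (ok ∘ rejects-sub-modal θ a ℓ hdℓ≡a (synth-𝓜 σ ψ g c adm))
    ...   | noᵈ hdℓ≢a = ⊥-elim (ok (rejects-sub-diamond θ a ℓ hdℓ≢a))

    𝓜-rejects-violation : ∀ φ {T} → ClosedFormula φ → MinFree φ → ¬ ⟦ φ ⟧∅ T → Rejects (𝓜 σ∅ φ) T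
    𝓜-rejects-violation φ {T} (g , _ , c) mf T∉φ =
      decidable-stable (rejects? (𝓜 σ∅ φ) T) λ ok →
        T∉φ (sat-if-neverRejects σ∅ φ g c mf (λ ()) admissible-∅ (λ ()) T
               (ok ∘ subst (λ m → Rejects m T) (sub-id (𝓜 σ∅ φ))))
      where
      admissible-∅ : Admissible [] (λ _ → nothing)
      admissible-∅ = record { defined = λ () ; closed = λ () ; synth = λ () }

  trace-step : ∀ T → T —[ hd T ]→ₜ tl T
  trace-step T ℓ = refl , λ _ → refl

  comm-run : ∀ {M M′ T} → M ⇒c M′ → ⟪ M ▷ T ⟫ ↣* ⟪ M′ ▷ T ⟫
  comm-run = gmap _ λ (_ , _ , _ , M→) → i-comm M→

  weakBisim-rejects : ∀ {R M m T} → WeakBisim R → R M m → Rejects m T → ⟪ M ▷ T ⟫ ↣* verdict no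
  weakBisim-rejects wb M~m (now m⇛no) with proj₂ (WeakBisim.wb-verdict wb M~m no) m⇛no
  ... | _ , M⇒M′ , M′⇛no = comm-run M⇒M′ ◅◅ i-verd M′⇛no ◅ ε
  weakBisim-rejects {T = T} wb M~m (step m→ _ r) with WeakBisim.wb-back wb M~m m→
  ... | _ , _ , _ , M⇒M₁ , M₁→M₂ , M₂⇒M′ , M′~m′ =
    comm-run M⇒M₁ ◅◅ i-act M₁→M₂ (trace-step T) ◅ comm-run M₂⇒M′ ◅◅ weakBisim-rejects wb M′~m′ r

excludedMiddle-lower : ∀ {ℓ} → ExcludedMiddle (lsuc ℓ) → ExcludedMiddle ℓ
excludedMiddle-lower em {P} = map′ lower lift (em {Lift _ P})

corollary4p6 : (nA′ nL′ k : ℕ) → let open Model nA′ nL′ k in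
    ExcludedMiddle (lsuc 0ℓ) →
    (𝒟 : DSynth) (T : HTrc) (φ : Formula) →
    ClosedFormula φ → MinFree φ →
    (D : DMon) → 𝒟 σ∅ φ ≡ just D →
    (R : DMon → CMon → Set) → WeakBisim R → R D (𝓜 σ∅ φ) →
    ¬ ⟦ φ ⟧∅ T →
    ⟪ D ▷ T ⟫ ↣* verdict no
corollary4p6 nA′ nL′ k em _ _ φ wf mf _ _ _ wb D~𝓜φ T∉φ =
  weakBisim-rejects wb D~𝓜φ (𝓜-rejects-violation (λ _ _ → excludedMiddle-lower em) φ wf mf T∉φ)
  where open Completeness nA′ nL′ k
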